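{- Let $\mathrm{NCN}^i(n)$ denote the number of partitions of $[n]=\{1,\dots,n\}$ that are noncrossing, nonnesting, and indecomposable. Then $\mathrm{NCN}^i(1)=1$, $\mathrm{NCN}^i(2)=1$, and $\mathrm{NCN}^i(n)=2\,\mathrm{NCN}^i(n-1)$ for $n>2$. Consequently $\sum_{n\ge1}\mathrm{NCN}^i(n)x^n=\frac{x-x^2}{1-2x}$.
   Context: A partition of $[n]$ is represented by its arc diagram: an arc $(i,j)$, $i<j$, is drawn whenever $i$ and $j$ are consecutive elements of the same block. Two arcs $(i_1,j_1),(i_2,j_2)$ cross if $i_1<i_2<j_1<j_2$ and nest if $i_1<i_2<j_2<j_1$. A partition is noncrossing (resp. nonnesting) if no two of its arcs cross (resp. nest). A partition of $[n]$ is indecomposable if no subset of its blocks forms a partition of $[k]$ for some $k<n$. -}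

module Defs where

open import Data.Nat using (ℕ; zero; suc; _+_; _*_; _∸_; _<ᵇ_; _≡ᵇ_; _⊔_)
open import Data.Bool using (Bool; true; false; _∧_; not; if_then_else_)
open import Data.List using (List; []; _∷_; _++_; [_]; map; concatMap; upTo)
open import Data.Bool.ListAction using (any; all)
open import Data.Nat.ListAction using (sum)

-- Set partitions of [n] are encoded by restricted growth strings (RGS):
-- a word w = w₀ w₁ … w_{n-1} with w₀ = 0 and w_{k} ≤ 1 + max(w₀ … w_{k-1}).
-- Element k+1 of [n] (position k, 0-based) lies in block number w_k; blocks are
-- numbered in order of their minimal elements.

nblocks : List ℕ → ℕ
nblocks []      = 0
nblocks (a ∷ w) = suc a ⊔ nblocks w

rgs : ℕ → List (List ℕ)
rgs zero    = [] ∷ []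
rgs (suc n) = concatMap (λ w → map (λ c → w ++ [ c ]) (upTo (suc (nblocks w)))) (rgs n)

-- label at position i (default 0 outside the word; only used for i < n)
at : List ℕ → ℕ → ℕ
at []      _       = 0
at (a ∷ w) zero    = a
at (a ∷ w) (suc i) = at w i

same : List ℕ → ℕ → ℕ → Bool
same w i j = at w i ≡ᵇ at w j

arc : ℕ → List ℕ → ℕ → ℕ → Bool
arc n w i j = (i <ᵇ j) ∧ same w i j
  ∧ not (any (λ k → (i <ᵇ k) ∧ (k <ᵇ j) ∧ same w i k) (upTo n))

someArcPair : ℕ → List ℕ → (ℕ → ℕ → ℕ → ℕ → Bool) → Bool
someArcPair n w rel =
  any (λ i1 → any (λ j1 → any (λ i2 → any (λ j2 →
    arc n w i1 j1 ∧ arc n w i2 j2 ∧ rel i1 j1 i2 j2) (upTo n)) (upTo n)) (upTo n)) (upTo n)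

noncrossing : ℕ → List ℕ → Bool
noncrossing n w = not (someArcPair n w (λ i1 j1 i2 j2 → (i1 <ᵇ i2) ∧ (i2 <ᵇ j1) ∧ (j1 <ᵇ j2)))

nonnesting : ℕ → List ℕ → Bool
nonnesting n w = not (someArcPair n w (λ i1 j1 i2 j2 → (i1 <ᵇ i2) ∧ (i2 <ᵇ j2) ∧ (j2 <ᵇ j1)))

-- the first k elements (positions 0..k-1) form a union of blocks,
-- i.e. some subset of the blocks is a partition of [k]
splitsAt : ℕ → List ℕ → ℕ → Bool
splitsAt n w k =
  all (λ i → all (λ j → not ((k <ᵇ suc j) ∧ (j <ᵇ n) ∧ same w i j)) (upTo n)) (upTo k)

indecomposable : ℕ → List ℕ → Bool
indecomposable n w = not (any (λ k → (0 <ᵇ k) ∧ splitsAt n w k) (upTo n))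

good : ℕ → List ℕ → Bool
good n w = noncrossing n w ∧ nonnesting n w ∧ indecomposable n w

NCNi : ℕ → ℕ
NCNi n = sum (map (λ w → if good n w then 1 else 0) (rgs n))

{-# OPTIONS --safe #-}
-- Read a restricted growth string w as the block labelling f = at w of {0, …, n-1}. If no two arcs
-- cross or nest, no arc of another block starts inside the span [x, y] of a block: the arc of that
-- block straddling its start would cross or nest it. Indecomposability allows no cut right after the
-- last element of the first block, so that block contains n-1, and every other block, lying inside its
-- span, is a singleton; conversely every such partition is good. Appending a label to a word of length
-- m+1 preserves "all other blocks are singletons" for exactly two labels, 0 and the fresh one, which
-- gives the doubling; demanding that the new element join the first block leaves only the label 0.
module Submission where

open import Defs
open import Data.Nat using (ℕ; _<_; _*_; _∸_)
open import Data.Product using (_×_)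
open import Relation.Binary.PropositionalEquality using (_≡_)

open import Data.Bool using (Bool; true; false; not; if_then_else_; T)
open import Data.Bool.ListAction using (any; all)
open import Data.Bool.Properties using (T-∧; T?)
open import Data.Empty using (⊥; ⊥-elim)
open import Data.List using (List; []; _∷_; _++_; [_]; map; concatMap; length; upTo; applyUpTo)
open import Data.List.Membership.Propositional using (_∈_; find)
open import Data.List.Membership.Propositional.Properties using (∈-concatMap⁻; ∈-map⁻; ∈-upTo⁻)
open import Data.List.Properties using (length-++; map-++; map-∘; map-cong; applyUpTo-∷ʳ)
open import Data.List.Relation.Unary.Any using (here; there)
import Data.List.Relation.Unary.All.Properties as All
import Data.List.Relation.Unary.Any.Properties as Any
open import Data.Nat using (zero; suc; _+_; _≤_; _⊔_; _<ᵇ_; z≤n; s≤s; z<s; s<s; _≟_; _<?_)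
open import Data.Nat.ListAction using (sum)
open import Data.Nat.ListAction.Properties using (sum-++)
open import Data.Nat.Properties
open import Algebra.Properties.CommutativeSemigroup +-commutativeSemigroup using (interchange)
open import Data.Product using (∃; ∃₂; _,_; proj₁; proj₂)
open import Data.Sum using (_⊎_; inj₁; inj₂; [_,_]′)
open import Function using (_∘_; id; case_of_; _⇔_; mk⇔; Equivalence)
import Function.Properties.Equivalence as ⇔
open import Relation.Binary.Definitions using (tri<; tri≈; tri>)
open import Relation.Binary.PropositionalEquality
  using (refl; sym; trans; cong; cong₂; subst; _≢_; module ≡-Reasoning)
open import Relation.Nullary using (¬_; Dec; yes; no; contradiction)
open import Relation.Nullary.Decidable using (⌊_⌋; toWitness; fromWitness; _×-dec_; _→-dec_)

open Equivalence using (to; from)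

T-not : ∀ {b} → T (not b) ⇔ (¬ T b)
T-not {true}  = mk⇔ (λ ()) (λ ¬t → ¬t _)
T-not {false} = mk⇔ (λ _ ()) _

¬T-not⇒T : ∀ {b} → ¬ T (not b) → T b
¬T-not⇒T {true}  _ = _
¬T-not⇒T {false} ¬t = ¬t _

module _ (p : ℕ → Bool) where

  any-upTo⁺ : ∀ {n k} → k < n → T (p k) → T (any p (upTo n))
  any-upTo⁺ k<n pk = Any.any⁺ p (Any.applyUpTo⁺ id pk k<n)

  any-upTo⁻ : ∀ n → T (any p (upTo n)) → ∃ λ k → k < n × T (p k)
  any-upTo⁻ n t = Any.applyUpTo⁻ id (Any.any⁻ p (upTo n) t)

  all-upTo⁻ : ∀ n → T (all p (upTo n)) → ∀ {k} → k < n → T (p k)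
  all-upTo⁻ n t = All.applyUpTo⁻ id n (All.all⁺ p (upTo n) t)

  ¬all-upTo⁻ : ∀ n → ¬ T (all p (upTo n)) → ∃ λ k → k < n × ¬ T (p k)
  ¬all-upTo⁻ n ¬t = Any.applyUpTo⁻ id (All.¬All⇒Any¬ (T? ∘ p) (upTo n) (¬t ∘ All.all⁻ p))

Arc : (ℕ → ℕ) → ℕ → ℕ → Set
Arc f i j = i < j × f i ≡ f j × (∀ {k} → i < k → k < j → f i ≢ f k)

-- Two arcs with i₁ < i₂ < j₁ cross or nest: j₁ = j₂ is excluded by the definition of Arc.
NonOverlapping : ℕ → (ℕ → ℕ) → Set
NonOverlapping n f = ∀ {i₁ j₁ i₂ j₂} → j₁ < n → j₂ < n →
  Arc f i₁ j₁ → Arc f i₂ j₂ → i₁ < i₂ → i₂ < j₁ → ⊥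

Indecomposable : ℕ → (ℕ → ℕ) → Set
Indecomposable n f = ∀ {k} → 0 < k → k < n → ∃₂ λ i j → i < k × k ≤ j × j < n × f i ≡ f j

module _ {n : ℕ} (w : List ℕ) where

  arc⇒Arc : ∀ {i j} → j < n → T (arc n w i j) → Arc (at w) i j
  arc⇒Arc {i} {j} j<n t =
    let i<j , t′ = to T-∧ t
        eq , noReturn = to T-∧ t′
        returnAt : ∀ {k} → i < k → k < j → at w i ≡ at w k → T (any _ (upTo n))
        returnAt i<k k<j e = any-upTo⁺ _ (<-trans k<j j<n)
          (from T-∧ (<⇒<ᵇ i<k , from T-∧ (<⇒<ᵇ k<j , ≡⇒≡ᵇ _ _ e)))
    in <ᵇ⇒< i j i<j , ≡ᵇ⇒≡ _ _ eq , λ i<k k<j e → to T-not noReturn (returnAt i<k k<j e)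

  Arc⇒arc : ∀ {i j} → Arc (at w) i j → T (arc n w i j)
  Arc⇒arc {i} {j} (i<j , e , between) =
    from T-∧ (<⇒<ᵇ i<j , from T-∧ (≡⇒≡ᵇ _ _ e , from T-not noReturn))
    where
    noReturn : ¬ T (any _ (upTo n))
    noReturn t =
      let k , _ , tk = any-upTo⁻ _ n t
          i<k , t′ = to T-∧ tk
          k<j , eq = to T-∧ t′
      in between (<ᵇ⇒< i k i<k) (<ᵇ⇒< k j k<j) (≡ᵇ⇒≡ _ _ eq)

  someArcPair⁺ : ∀ rel {i₁ j₁ i₂ j₂} → j₁ < n → j₂ < n →
    Arc (at w) i₁ j₁ → Arc (at w) i₂ j₂ → T (rel i₁ j₁ i₂ j₂) → T (someArcPair n w rel)
  someArcPair⁺ rel j₁<n j₂<n a₁ a₂ r =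
    any-upTo⁺ _ (<-trans (proj₁ a₁) j₁<n) (any-upTo⁺ _ j₁<n
      (any-upTo⁺ _ (<-trans (proj₁ a₂) j₂<n) (any-upTo⁺ _ j₂<n
        (from T-∧ (Arc⇒arc a₁ , from T-∧ (Arc⇒arc a₂ , r))))))

  someArcPair⁻ : ∀ rel → T (someArcPair n w rel) → ∃₂ λ i₁ j₁ → ∃₂ λ i₂ j₂ →
    j₁ < n × j₂ < n × Arc (at w) i₁ j₁ × Arc (at w) i₂ j₂ × T (rel i₁ j₁ i₂ j₂)
  someArcPair⁻ rel t =
    let i₁ , _ , t₁ = any-upTo⁻ _ n t
        j₁ , j₁<n , t₂ = any-upTo⁻ _ n t₁
        i₂ , _ , t₃ = any-upTo⁻ _ n t₂
        j₂ , j₂<n , t₄ = any-upTo⁻ _ n t₃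
        a₁ , t₅ = to T-∧ t₄
        a₂ , r = to T-∧ t₅
    in i₁ , j₁ , i₂ , j₂ , j₁<n , j₂<n , arc⇒Arc j₁<n a₁ , arc⇒Arc j₂<n a₂ , r

  NonOverlapping⇒¬someArcPair : NonOverlapping n (at w) → ∀ rel →
    (∀ {i₁ j₁ i₂ j₂} → T (rel i₁ j₁ i₂ j₂) → i₁ < i₂ × i₂ < j₁) → ¬ T (someArcPair n w rel)
  NonOverlapping⇒¬someArcPair nonOverlapping rel overlapping t =
    let _ , _ , _ , _ , j₁<n , j₂<n , a₁ , a₂ , r = someArcPair⁻ rel t
        i₁<i₂ , i₂<j₁ = overlapping r
    in nonOverlapping j₁<n j₂<n a₁ a₂ i₁<i₂ i₂<j₁

  NonOverlapping⇒noncrossing : NonOverlapping n (at w) → T (noncrossing n w)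
  NonOverlapping⇒noncrossing nonOverlapping =
    from T-not (NonOverlapping⇒¬someArcPair nonOverlapping _ λ {i₁} {j₁} {i₂} t →
      let i₁<i₂ , t′ = to T-∧ t in <ᵇ⇒< i₁ i₂ i₁<i₂ , <ᵇ⇒< i₂ j₁ (proj₁ (to T-∧ t′)))

  NonOverlapping⇒nonnesting : NonOverlapping n (at w) → T (nonnesting n w)
  NonOverlapping⇒nonnesting nonOverlapping =
    from T-not (NonOverlapping⇒¬someArcPair nonOverlapping _ λ {i₁} {j₁} {i₂} {j₂} t →
      let i₁<i₂ , t′ = to T-∧ t
          i₂<j₂ , j₂<j₁ = to T-∧ t′
      in <ᵇ⇒< i₁ i₂ i₁<i₂ , <-trans (<ᵇ⇒< i₂ j₂ i₂<j₂) (<ᵇ⇒< j₂ j₁ j₂<j₁))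

  noncrossing×nonnesting⇒NonOverlapping :
    T (noncrossing n w) → T (nonnesting n w) → NonOverlapping n (at w)
  noncrossing×nonnesting⇒NonOverlapping nc nn {i₁} {j₁} {i₂} {j₂}
    j₁<n j₂<n a₁@(_ , e₁ , between₁) a₂@(i₂<j₂ , e₂ , _) i₁<i₂ i₂<j₁ with <-cmp j₁ j₂
  ... | tri< j₁<j₂ _ _ = to T-not nc (someArcPair⁺ _ j₁<n j₂<n a₁ a₂
          (from T-∧ (<⇒<ᵇ i₁<i₂ , from T-∧ (<⇒<ᵇ i₂<j₁ , <⇒<ᵇ j₁<j₂))))
  ... | tri> _ _ j₂<j₁ = to T-not nn (someArcPair⁺ _ j₁<n j₂<n a₁ a₂
          (from T-∧ (<⇒<ᵇ i₁<i₂ , from T-∧ (<⇒<ᵇ i₂<j₂ , <⇒<ᵇ j₂<j₁))))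
  ... | tri≈ _ refl _ = between₁ i₁<i₂ i₂<j₁ (trans e₁ (sym e₂))

  indecomposable⇒Indecomposable : T (indecomposable n w) → Indecomposable n (at w)
  indecomposable⇒Indecomposable t {k} 0<k k<n =
    let ¬splits = λ s → to T-not t (any-upTo⁺ _ k<n (from T-∧ (<⇒<ᵇ 0<k , s)))
        i , i<k , ¬t = ¬all-upTo⁻ _ k ¬splits
        j , j<n , ¬t′ = ¬all-upTo⁻ _ n ¬t
        k<1+j , t′ = to T-∧ (¬T-not⇒T ¬t′)
    in i , j , i<k , ≤-pred (<ᵇ⇒< k (suc j) k<1+j) , j<n , ≡ᵇ⇒≡ _ _ (proj₂ (to T-∧ t′))

  Indecomposable⇒indecomposable : Indecomposable n (at w) → T (indecomposable n w)
  Indecomposable⇒indecomposable ind = from T-not λ t →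
    let k , k<n , tk = any-upTo⁻ _ n t
        0<k , splits = to T-∧ tk
        i , j , i<k , k≤j , j<n , e = ind (<ᵇ⇒< 0 k 0<k) k<n
    in to T-not (all-upTo⁻ _ n (all-upTo⁻ _ k splits i<k) j<n)
         (from T-∧ (<⇒<ᵇ (s≤s k≤j) , from T-∧ (<⇒<ᵇ j<n , ≡⇒≡ᵇ _ _ e)))

  good⇔NonOverlapping×Indecomposable :
    T (good n w) ⇔ (NonOverlapping n (at w) × Indecomposable n (at w))
  good⇔NonOverlapping×Indecomposable = mk⇔ good⇒ ⇒good
    where
    good⇒ : T (good n w) → NonOverlapping n (at w) × Indecomposable n (at w)
    good⇒ t = let nc , t′ = to T-∧ t
                  nn , ind = to T-∧ t′
              in noncrossing×nonnesting⇒NonOverlapping nc nn , indecomposable⇒Indecomposable ind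

    ⇒good : NonOverlapping n (at w) × Indecomposable n (at w) → T (good n w)
    ⇒good (nonOverlapping , ind) = from T-∧ (NonOverlapping⇒noncrossing nonOverlapping ,
      from T-∧ (NonOverlapping⇒nonnesting nonOverlapping , Indecomposable⇒indecomposable ind))

module _ (f : ℕ → ℕ) where

  returnBefore? : ∀ i m → (∀ {k} → i < k → k < m → f i ≢ f k) ⊎ ∃ λ b → b < m × Arc f i b
  returnBefore? i zero = inj₁ λ _ ()
  returnBefore? i (suc m) with returnBefore? i m
  ... | inj₂ (b , b<m , arc) = inj₂ (b , m<n⇒m<1+n b<m , arc)
  ... | inj₁ none with (i <? m) ×-dec (f i ≟ f m)
  ...   | yes (i<m , e) = inj₂ (m , n<1+n m , i<m , e , none)
  ...   | no ¬return    = inj₁ λ i<k k<1+m →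
            [ none i<k , (λ { refl e → ¬return (i<k , e) }) ]′ (m<1+n⇒m<n∨m≡n k<1+m)

  firstReturn : ∀ {i j} → i < j → f i ≡ f j → ∃ λ b → b ≤ j × Arc f i b
  firstReturn {i} {j} i<j e with returnBefore? i j
  ... | inj₁ none              = j , ≤-refl , i<j , e , none
  ... | inj₂ (b , b<j , arc) = b , <⇒≤ b<j , arc

  lastBefore : ∀ {x} m → x < m → ∃ λ a → a < m × f a ≡ f x × (∀ {k} → a < k → k < m → f k ≢ f x)
  lastBefore {x} (suc m) x<1+m with f m ≟ f x | m<1+n⇒m<n∨m≡n x<1+m
  ... | yes e  | _         = m , n<1+n m , e , λ m<k k<1+m → contradiction (≤-pred k<1+m) (<⇒≱ m<k)
  ... | no  ne | inj₂ refl = contradiction refl ne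
  ... | no  ne | inj₁ x<m  =
    let a , a<m , e , after = lastBefore m x<m
    in a , m<n⇒m<1+n a<m , e , λ a<k k<1+m →
         [ after a<k , (λ { refl → ne }) ]′ (m<1+n⇒m<n∨m≡n k<1+m)

  -- (a, b) is the arc leaving the last element of x's block before k.
  straddlingArc : ∀ {x y k} → f x ≡ f y → x < k → k ≤ y →
    ∃₂ λ a b → a < k × k ≤ b × b ≤ y × f a ≡ f x × Arc f a b
  straddlingArc e x<k k≤y =
    let a , a<k , ea , after = lastBefore _ x<k
        b , b≤y , arc = firstReturn (<-≤-trans a<k k≤y) (trans ea e)
        a<b , eab , _ = arc
    in a , b , a<k , ≮⇒≥ (λ b<k → after a<b b<k (trans (sym eab) ea)) , b≤y , ea , arc

  arcInSpan⇒sameBlock : ∀ {n x y a b} → NonOverlapping n f → f x ≡ f y → y < n →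
    x ≤ a → a ≤ y → Arc f a b → b < n → f a ≡ f x
  arcInSpan⇒sameBlock {a = a} nonOverlapping exy y<n x≤a a≤y arc b<n with f a ≟ f _
  ... | yes e = e
  ... | no ne =
    let a<y = ≤∧≢⇒< a≤y (λ { refl → ne (sym exy) })
        c , d , c<1+a , 1+a≤d , d≤y , ec , arcCD = straddlingArc exy (s≤s x≤a) a<y
        c<a = ≤∧≢⇒< (≤-pred c<1+a) (λ c≡a → ne (trans (cong f (sym c≡a)) ec))
    in ⊥-elim (nonOverlapping (≤-<-trans d≤y y<n) b<n arcCD arc c<a 1+a≤d)

OnlyFirstBlockRepeats : ℕ → (ℕ → ℕ) → Set
OnlyFirstBlockRepeats n f = ∀ {j} → j < n → ∀ {i} → i < j → f i ≡ f j → f i ≡ f 0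

Spanning : ℕ → (ℕ → ℕ) → Set
Spanning n f = OnlyFirstBlockRepeats (suc n) f × f n ≡ f 0

module _ {n} {f : ℕ → ℕ} (nonOverlapping : NonOverlapping (suc n) f) (ind : Indecomposable (suc n) f) where

  lastInFirstBlock : f n ≡ f 0
  lastInFirstBlock with lastBefore f (suc n) z<s
  ... | m , m<1+n , em , after with m<1+n⇒m<n∨m≡n m<1+n
  ...   | inj₂ refl = em
  ...   | inj₁ m<n  =
    let i , j , i<1+m , 1+m≤j , j<1+n , eij = ind z<s (s<s m<n)
        a , b , a<1+m , 1+m≤b , b≤j , _ , arc = straddlingArc f eij i<1+m 1+m≤j
        _ , eab , _ = arc
        b<1+n = ≤-<-trans b≤j j<1+n
        ea = arcInSpan⇒sameBlock f nonOverlapping (sym em) (m<n⇒m<1+n m<n) z≤n (≤-pred a<1+m) arc b<1+n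
    in contradiction (trans (sym eab) ea) (after 1+m≤b b<1+n)

  onlyFirstBlockRepeats : OnlyFirstBlockRepeats (suc n) f
  onlyFirstBlockRepeats j<1+n i<j e =
    let _ , b≤j , arc = firstReturn f i<j e
    in arcInSpan⇒sameBlock f nonOverlapping (sym lastInFirstBlock) (n<1+n n) z≤n
         (<⇒≤ (<-≤-trans i<j (≤-pred j<1+n))) arc (≤-<-trans b≤j j<1+n)

module _ {n} {f : ℕ → ℕ} (only : OnlyFirstBlockRepeats n f) where

  onlyFirstBlockRepeats⇒NonOverlapping : NonOverlapping n f
  onlyFirstBlockRepeats⇒NonOverlapping
    j₁<n j₂<n (i₁<j₁ , e₁ , between₁) (i₂<j₂ , e₂ , _) i₁<i₂ i₂<j₁ =
    between₁ i₁<i₂ i₂<j₁ (trans (only j₁<n i₁<j₁ e₁) (sym (only j₂<n i₂<j₂ e₂)))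

lastInFirstBlock⇒Indecomposable : ∀ {n f} → f n ≡ f 0 → Indecomposable (suc n) f
lastInFirstBlock⇒Indecomposable {n} last 0<k k<1+n = 0 , n , 0<k , ≤-pred k<1+n , n<1+n n , sym last

NonOverlapping×Indecomposable⇔Spanning : ∀ {n f} →
  (NonOverlapping (suc n) f × Indecomposable (suc n) f) ⇔ Spanning n f
NonOverlapping×Indecomposable⇔Spanning = mk⇔
  (λ (nonOverlapping , ind) → onlyFirstBlockRepeats nonOverlapping ind , lastInFirstBlock nonOverlapping ind)
  (λ (only , last) → onlyFirstBlockRepeats⇒NonOverlapping only , lastInFirstBlock⇒Indecomposable last)

onlyFirstBlockRepeats? : ∀ n f → Dec (OnlyFirstBlockRepeats n f)
onlyFirstBlockRepeats? n f = allUpTo? (λ j → allUpTo? (λ i → (f i ≟ f j) →-dec (f i ≟ f 0)) j) n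

spanning? : ∀ n f → Dec (Spanning n f)
spanning? n f = onlyFirstBlockRepeats? (suc n) f ×-dec (f n ≟ f 0)

module _ {g : ℕ → ℕ} where

  onlyFirstBlockRepeats-cong : ∀ {f n} → (∀ {i} → i < n → f i ≡ g i) →
    OnlyFirstBlockRepeats n f → OnlyFirstBlockRepeats n g
  onlyFirstBlockRepeats-cong agree only j<n i<j e =
    let fi = agree (<-trans i<j j<n)
        fj = agree j<n
        f0 = agree (≤-<-trans z≤n j<n)
    in trans (sym fi) (trans (only j<n i<j (trans fi (trans e (sym fj)))) f0)

  onlyFirstBlockRepeats-≤ : ∀ {m n} → m ≤ n → OnlyFirstBlockRepeats n g → OnlyFirstBlockRepeats m g
  onlyFirstBlockRepeats-≤ m≤n only j<m = only (<-≤-trans j<m m≤n)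

  onlyFirstBlockRepeats-suc : ∀ {m} → OnlyFirstBlockRepeats m g →
    g m ≡ g 0 ⊎ (∀ {i} → i < m → g i ≢ g m) → OnlyFirstBlockRepeats (suc m) g
  onlyFirstBlockRepeats-suc only last j<1+m i<j e with m<1+n⇒m<n∨m≡n j<1+m | last
  ... | inj₁ j<m  | _               = only j<m i<j e
  ... | inj₂ refl | inj₁ inFirst    = trans e inFirst
  ... | inj₂ refl | inj₂ singleton  = contradiction e (singleton i<j)

  onlyFirstBlockRepeats-singleton : ∀ {m} → OnlyFirstBlockRepeats (suc m) g → g m ≢ g 0 →
    ∀ {i} → i < m → g i ≢ g m
  onlyFirstBlockRepeats-singleton {m} only notFirst i<m e = notFirst (trans (sym e) (only (n<1+n m) i<m e))

at-++-< : ∀ (w : List ℕ) c {i} → i < length w → at (w ++ [ c ]) i ≡ at w i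
at-++-< (a ∷ w) c {zero}  _         = refl
at-++-< (a ∷ w) c {suc i} (s<s i<n) = at-++-< w c i<n

at-++-length : ∀ (w : List ℕ) c → at (w ++ [ c ]) (length w) ≡ c
at-++-length []      c = refl
at-++-length (a ∷ w) c = at-++-length w c

at<nblocks : ∀ (w : List ℕ) {i} → i < length w → at w i < nblocks w
at<nblocks (a ∷ w) {zero}  _         = m≤m⊔n (suc a) (nblocks w)
at<nblocks (a ∷ w) {suc i} (s<s i<n) = ≤-trans (at<nblocks w i<n) (m≤n⊔m (suc a) (nblocks w))

nblocks-++ : ∀ (w : List ℕ) c → nblocks (w ++ [ c ]) ≡ nblocks w ⊔ suc c
nblocks-++ []      c = refl
nblocks-++ (a ∷ w) c = trans (cong (suc a ⊔_) (nblocks-++ w c)) (sym (⊔-assoc (suc a) (nblocks w) (suc c)))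

<nblocks-++⁻ : ∀ w {c d} → c ≤ nblocks w → d < nblocks (w ++ [ c ]) → d < nblocks w ⊎ d ≡ c
<nblocks-++⁻ w {c} {d} c≤M d< with m≤n⇒m<n∨m≡n c≤M
... | inj₁ c<M = inj₁ (subst (d <_) (trans (nblocks-++ w c) (m≥n⇒m⊔n≡m c<M)) d<)
... | inj₂ refl = m<1+n⇒m<n∨m≡n (subst (d <_) (trans (nblocks-++ w c) (m≤n⇒m⊔n≡n (n≤1+n c))) d<)

LabelsOccur : ℕ → List ℕ → Set
LabelsOccur n w = ∀ {d} → d < nblocks w → ∃ λ i → i < n × at w i ≡ d

labelsOccur-++ : ∀ w {n c} → length w ≡ n → c ≤ nblocks w →
  LabelsOccur n w → LabelsOccur (suc n) (w ++ [ c ])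
labelsOccur-++ w {c = c} refl c≤M occur d< with <nblocks-++⁻ w c≤M d<
... | inj₁ d<M = let i , i<n , e = occur d<M in i , m<n⇒m<1+n i<n , trans (at-++-< w c i<n) e
... | inj₂ refl = length w , n<1+n (length w) , at-++-length w c

∈-rgs-suc⁻ : ∀ n {v} → v ∈ rgs (suc n) → ∃₂ λ w c → w ∈ rgs n × c ≤ nblocks w × v ≡ w ++ [ c ]
∈-rgs-suc⁻ n v∈ =
  let w , w∈ , v∈ext = find (∈-concatMap⁻ _ {xs = rgs n} v∈)
      c , c∈ , v≡ = ∈-map⁻ _ v∈ext
  in w , c , w∈ , ≤-pred (∈-upTo⁻ c∈) , v≡

rgs-length : ∀ n {w} → w ∈ rgs n → length w ≡ n
rgs-length zero    (here refl) = refl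
rgs-length (suc n) w∈ with ∈-rgs-suc⁻ n w∈
... | v , c , v∈ , _ , refl = trans (length-++ v) (trans (+-comm (length v) 1) (cong suc (rgs-length n v∈)))

rgs-head : ∀ n {w} → w ∈ rgs (suc n) → at w 0 ≡ 0
rgs-head zero w∈ with ∈-rgs-suc⁻ 0 w∈
... | _ , _ , here refl , z≤n , refl = refl
rgs-head (suc n) w∈ with ∈-rgs-suc⁻ (suc n) w∈
... | v , c , v∈ , _ , refl =
  trans (at-++-< v c (subst (0 <_) (sym (rgs-length (suc n) v∈)) z<s)) (rgs-head n v∈)

rgs-labelsOccur : ∀ n {w} → w ∈ rgs n → LabelsOccur n w
rgs-labelsOccur zero    (here refl) ()
rgs-labelsOccur (suc n) w∈ with ∈-rgs-suc⁻ n w∈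
... | v , c , v∈ , c≤M , refl = labelsOccur-++ v (rgs-length n v∈) c≤M (rgs-labelsOccur n v∈)

indicator : Bool → ℕ
indicator b = if b then 1 else 0

count : ∀ {A : Set} → (A → Bool) → List A → ℕ
count p xs = sum (map (indicator ∘ p) xs)

indicator-cong : ∀ {a b} → (T a ⇔ T b) → indicator a ≡ indicator b
indicator-cong {true}  {true}  _ = refl
indicator-cong {true}  {false} h = ⊥-elim (to h _)
indicator-cong {false} {true}  h = ⊥-elim (from h _)
indicator-cong {false} {false} _ = refl

indicator-⌊⌋-cong : ∀ {A B : Set} (A? : Dec A) (B? : Dec B) →
  A ⇔ B → indicator ⌊ A? ⌋ ≡ indicator ⌊ B? ⌋
indicator-⌊⌋-cong (yes _) (yes _)  _ = refl
indicator-⌊⌋-cong (yes a) (no ¬b)  h = contradiction (to h a) ¬b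
indicator-⌊⌋-cong (no ¬a) (yes b)  h = contradiction (from h b) ¬a
indicator-⌊⌋-cong (no _)  (no _)   _ = refl

T-⌊⌋ : ∀ {A : Set} (A? : Dec A) → T ⌊ A? ⌋ ⇔ A
T-⌊⌋ A? = mk⇔ toWitness fromWitness

sum-map-cong : ∀ {A : Set} {F G : A → ℕ} {xs} →
  (∀ {x} → x ∈ xs → F x ≡ G x) → sum (map F xs) ≡ sum (map G xs)
sum-map-cong {xs = []}     _  = refl
sum-map-cong {xs = x ∷ xs} eq = cong₂ _+_ (eq (here refl)) (sum-map-cong (eq ∘ there))

sum-map-+ : ∀ {A : Set} (F G : A → ℕ) xs →
  sum (map (λ x → F x + G x) xs) ≡ sum (map F xs) + sum (map G xs)
sum-map-+ F G []       = refl
sum-map-+ F G (x ∷ xs) = trans (cong (F x + G x +_) (sum-map-+ F G xs)) (interchange (F x) (G x) _ _)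

count-cong : ∀ {A : Set} {p q : A → Bool} {xs} →
  (∀ {x} → x ∈ xs → T (p x) ⇔ T (q x)) → count p xs ≡ count q xs
count-cong eq = sum-map-cong (indicator-cong ∘ eq)

module _ {A : Set} (p : A → Bool) where

  count-++ : ∀ xs ys → count p (xs ++ ys) ≡ count p xs + count p ys
  count-++ xs ys = trans (cong sum (map-++ (indicator ∘ p) xs ys)) (sum-++ (map (indicator ∘ p) xs) _)

  count-map : ∀ {B : Set} (g : B → A) xs → count p (map g xs) ≡ count (p ∘ g) xs
  count-map g xs = cong sum (sym (map-∘ xs))

  count-concatMap : ∀ {B : Set} (h : B → List A) xs → count p (concatMap h xs) ≡ sum (map (count p ∘ h) xs)
  count-concatMap h []       = refl
  count-concatMap h (x ∷ xs) =
    trans (count-++ (h x) (concatMap h xs)) (cong (count p (h x) +_) (count-concatMap h xs))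

count-applyUpTo-suc : ∀ (p : ℕ → Bool) f N →
  count p (applyUpTo f (suc N)) ≡ count p (applyUpTo f N) + indicator (p (f N))
count-applyUpTo-suc p f N = begin
  count p (applyUpTo f (suc N))               ≡⟨ cong (count p) (applyUpTo-∷ʳ f N) ⟨
  count p (applyUpTo f N ++ [ f N ])          ≡⟨ count-++ p (applyUpTo f N) [ f N ] ⟩
  count p (applyUpTo f N) + (indicator (p (f N)) + 0) ≡⟨ cong (count p (applyUpTo f N) +_) (+-identityʳ _) ⟩
  count p (applyUpTo f N) + indicator (p (f N)) ∎
  where open ≡-Reasoning

module _ {P : ℕ → Set} (P? : ∀ c → Dec (P c)) where

  count-applyUpTo-none : ∀ f N → (∀ {k} → k < N → ¬ P (f k)) → count (⌊_⌋ ∘ P?) (applyUpTo f N) ≡ 0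
  count-applyUpTo-none f zero    _    = refl
  count-applyUpTo-none f (suc N) none with P? (f 0)
  ... | yes p = contradiction p (none z<s)
  ... | no  _ = count-applyUpTo-none (f ∘ suc) N (none ∘ s<s)

  module _ {B : Set} (B? : Dec B) where

    count-upTo-zero : ∀ M → (∀ {c} → c ≤ M → P c ⇔ (B × c ≡ 0)) →
      count (⌊_⌋ ∘ P?) (upTo (suc M)) ≡ indicator ⌊ B? ⌋
    count-upTo-zero M spec = trans (cong₂ _+_
      (indicator-⌊⌋-cong (P? 0) B? (mk⇔ (proj₁ ∘ to (spec z≤n)) (λ b → from (spec z≤n) (b , refl))))
      (count-applyUpTo-none suc M λ k<M p → case proj₂ (to (spec k<M) p) of λ ()))
      (+-identityʳ _)

    count-upTo-zeroOrTop : ∀ M → 0 < M → (∀ {c} → c ≤ M → P c ⇔ (B × (c ≡ 0 ⊎ c ≡ M))) →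
      count (⌊_⌋ ∘ P?) (upTo (suc M)) ≡ indicator ⌊ B? ⌋ + indicator ⌊ B? ⌋
    count-upTo-zeroOrTop (suc M) _ spec = begin
      indicator ⌊ P? 0 ⌋ + count p (applyUpTo suc (suc M))
        ≡⟨ cong (indicator ⌊ P? 0 ⌋ +_) (count-applyUpTo-suc p suc M) ⟩
      indicator ⌊ P? 0 ⌋ + (count p (applyUpTo suc M) + indicator ⌊ P? (suc M) ⌋)
        ≡⟨ cong₂ _+_ (indicator-⌊⌋-cong (P? 0) B? (endpoint z≤n (inj₁ refl)))
                     (cong₂ _+_ (count-applyUpTo-none suc M inner)
                                (indicator-⌊⌋-cong (P? (suc M)) B? (endpoint ≤-refl (inj₂ refl)))) ⟩
      indicator ⌊ B? ⌋ + (0 + indicator ⌊ B? ⌋) ∎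
      where
      open ≡-Reasoning
      p : ℕ → Bool
      p = ⌊_⌋ ∘ P?
      endpoint : ∀ {c} → c ≤ suc M → c ≡ 0 ⊎ c ≡ suc M → P c ⇔ B
      endpoint c≤ end = mk⇔ (proj₁ ∘ to (spec c≤)) (λ b → from (spec c≤) (b , end))
      inner : ∀ {k} → k < M → ¬ P (suc k)
      inner k<M p = case proj₂ (to (spec (<⇒≤ (s<s k<M))) p) of λ
        { (inj₁ ())
        ; (inj₂ e) → <-irrefl (suc-injective e) k<M }

module _ {m w} (w∈ : w ∈ rgs (suc m)) where

  private
    <length : ∀ {i} → i < suc m → i < length w
    <length = subst (_ <_) (sym (rgs-length (suc m) w∈))

    agree : ∀ c {i} → i < suc m → at w i ≡ at (w ++ [ c ]) i
    agree c i<1+m = sym (at-++-< w c (<length i<1+m))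

    last : ∀ c → at (w ++ [ c ]) (suc m) ≡ c
    last c = subst (λ k → at (w ++ [ c ]) k ≡ c) (rgs-length (suc m) w∈) (at-++-length w c)

    first : ∀ c → at (w ++ [ c ]) 0 ≡ 0
    first c = trans (sym (agree c z<s)) (rgs-head m w∈)

    restrict : ∀ {c n} → suc m ≤ n →
      OnlyFirstBlockRepeats n (at (w ++ [ c ])) → OnlyFirstBlockRepeats (suc m) (at w)
    restrict {c} 1+m≤n only = onlyFirstBlockRepeats-cong (sym ∘ agree c) (onlyFirstBlockRepeats-≤ 1+m≤n only)

  spanning-++⇔ : ∀ c → Spanning (suc m) (at (w ++ [ c ])) ⇔ (OnlyFirstBlockRepeats (suc m) (at w) × c ≡ 0)
  spanning-++⇔ c = mk⇔ toParts fromParts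
    where
    toParts : Spanning (suc m) (at (w ++ [ c ])) → OnlyFirstBlockRepeats (suc m) (at w) × c ≡ 0
    toParts (only , lastInFirst) = restrict (n≤1+n _) only , trans (sym (last c)) (trans lastInFirst (first c))

    fromParts : OnlyFirstBlockRepeats (suc m) (at w) × c ≡ 0 → Spanning (suc m) (at (w ++ [ c ]))
    fromParts (only , refl) =
      onlyFirstBlockRepeats-suc (onlyFirstBlockRepeats-cong (agree 0) only) (inj₁ last≡first) , last≡first
      where
      last≡first : at (w ++ [ 0 ]) (suc m) ≡ at (w ++ [ 0 ]) 0
      last≡first = trans (last 0) (sym (first 0))

  onlyFirstBlockRepeats-++⇔ : ∀ {c} → c ≤ nblocks w →
    OnlyFirstBlockRepeats (suc (suc m)) (at (w ++ [ c ]))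
      ⇔ (OnlyFirstBlockRepeats (suc m) (at w) × (c ≡ 0 ⊎ c ≡ nblocks w))
  onlyFirstBlockRepeats-++⇔ {c} c≤M = mk⇔ toParts fromParts
    where
    newLabel : OnlyFirstBlockRepeats (suc (suc m)) (at (w ++ [ c ])) → c ≡ 0 ⊎ c ≡ nblocks w
    newLabel only with c ≟ 0
    ... | yes c≡0 = inj₁ c≡0
    ... | no  c≢0 = inj₂ (≤-antisym c≤M (≮⇒≥ λ c<M →
      let i , i<1+m , e = rgs-labelsOccur (suc m) w∈ c<M
      in onlyFirstBlockRepeats-singleton only (λ e′ → c≢0 (trans (sym (last c)) (trans e′ (first c))))
           i<1+m (trans (sym (agree c i<1+m)) (trans e (sym (last c))))))

    toParts : OnlyFirstBlockRepeats (suc (suc m)) (at (w ++ [ c ])) →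
      OnlyFirstBlockRepeats (suc m) (at w) × (c ≡ 0 ⊎ c ≡ nblocks w)
    toParts only = restrict (n≤1+n _) only , newLabel only

    fromParts : OnlyFirstBlockRepeats (suc m) (at w) × (c ≡ 0 ⊎ c ≡ nblocks w) →
      OnlyFirstBlockRepeats (suc (suc m)) (at (w ++ [ c ]))
    fromParts (only , inj₁ refl) =
      onlyFirstBlockRepeats-suc (onlyFirstBlockRepeats-cong (agree 0) only)
        (inj₁ (trans (last 0) (sym (first 0))))
    fromParts (only , inj₂ refl) =
      onlyFirstBlockRepeats-suc (onlyFirstBlockRepeats-cong (agree c) only) (inj₂ λ i<1+m e →
        <-irrefl (trans (agree c i<1+m) (trans e (last c))) (at<nblocks w (<length i<1+m)))

  count-spanning-++ : count (λ c → ⌊ spanning? (suc m) (at (w ++ [ c ])) ⌋) (upTo (suc (nblocks w)))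
    ≡ indicator ⌊ onlyFirstBlockRepeats? (suc m) (at w) ⌋
  count-spanning-++ = count-upTo-zero (λ c → spanning? (suc m) (at (w ++ [ c ])))
    (onlyFirstBlockRepeats? (suc m) (at w)) (nblocks w) (λ _ → spanning-++⇔ _)

  count-onlyFirstBlockRepeats-++ :
    count (λ c → ⌊ onlyFirstBlockRepeats? (suc (suc m)) (at (w ++ [ c ])) ⌋) (upTo (suc (nblocks w)))
    ≡ indicator ⌊ onlyFirstBlockRepeats? (suc m) (at w) ⌋ + indicator ⌊ onlyFirstBlockRepeats? (suc m) (at w) ⌋
  count-onlyFirstBlockRepeats-++ =
    count-upTo-zeroOrTop (λ c → onlyFirstBlockRepeats? (suc (suc m)) (at (w ++ [ c ])))
      (onlyFirstBlockRepeats? (suc m) (at w)) (nblocks w) (≤-<-trans z≤n (at<nblocks w (<length z<s)))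
      onlyFirstBlockRepeats-++⇔

count-rgs-suc : ∀ (p : List ℕ → Bool) n →
  count p (rgs (suc n)) ≡ sum (map (λ w → count (λ c → p (w ++ [ c ])) (upTo (suc (nblocks w)))) (rgs n))
count-rgs-suc p n = trans (count-concatMap p _ (rgs n))
  (cong sum (map-cong (λ w → count-map p (λ c → w ++ [ c ]) (upTo (suc (nblocks w)))) (rgs n)))

onlyFirstBlockRepeatsCount : ℕ → ℕ
onlyFirstBlockRepeatsCount n = count (λ w → ⌊ onlyFirstBlockRepeats? n (at w) ⌋) (rgs n)

NCNi≡spanningCount : ∀ n → NCNi (suc n) ≡ count (λ w → ⌊ spanning? n (at w) ⌋) (rgs (suc n))
NCNi≡spanningCount n = count-cong {xs = rgs (suc n)} λ {w} _ →
  ⇔.trans (good⇔NonOverlapping×Indecomposable w)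
    (⇔.trans NonOverlapping×Indecomposable⇔Spanning (⇔.sym (T-⌊⌋ (spanning? n (at w)))))

NCNi≡onlyFirstBlockRepeatsCount : ∀ m → NCNi (suc (suc m)) ≡ onlyFirstBlockRepeatsCount (suc m)
NCNi≡onlyFirstBlockRepeatsCount m =
  trans (NCNi≡spanningCount (suc m))
    (trans (count-rgs-suc _ (suc m)) (sum-map-cong {xs = rgs (suc m)} (count-spanning-++ {m})))

onlyFirstBlockRepeatsCount-suc : ∀ m →
  onlyFirstBlockRepeatsCount (suc (suc m)) ≡ 2 * onlyFirstBlockRepeatsCount (suc m)
onlyFirstBlockRepeatsCount-suc m = begin
  onlyFirstBlockRepeatsCount (2 + m)
    ≡⟨ count-rgs-suc _ (suc m) ⟩
  sum (map (λ w → count (extensions w) (upTo (suc (nblocks w)))) (rgs (suc m)))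
    ≡⟨ sum-map-cong {xs = rgs (suc m)} (count-onlyFirstBlockRepeats-++ {m}) ⟩
  sum (map (λ w → indicator (q w) + indicator (q w)) (rgs (suc m)))
    ≡⟨ sum-map-+ (indicator ∘ q) (indicator ∘ q) (rgs (suc m)) ⟩
  S + S
    ≡⟨ cong (S +_) (+-identityʳ S) ⟨
  2 * S ∎
  where
  open ≡-Reasoning
  extensions : List ℕ → ℕ → Bool
  extensions w c = ⌊ onlyFirstBlockRepeats? (2 + m) (at (w ++ [ c ])) ⌋
  q : List ℕ → Bool
  q w = ⌊ onlyFirstBlockRepeats? (suc m) (at w) ⌋
  S : ℕ
  S = onlyFirstBlockRepeatsCount (suc m)

lemma5p1 : (NCNi 1 ≡ 1) × (NCNi 2 ≡ 1) × ((n : ℕ) → 2 < n → NCNi n ≡ 2 * NCNi (n ∸ 1))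
lemma5p1 = refl , refl , doubling
  where
  doubling : (n : ℕ) → 2 < n → NCNi n ≡ 2 * NCNi (n ∸ 1)
  doubling (suc (suc (suc k))) _ = begin
    NCNi (3 + k)                          ≡⟨ NCNi≡onlyFirstBlockRepeatsCount (suc k) ⟩
    onlyFirstBlockRepeatsCount (2 + k)     ≡⟨ onlyFirstBlockRepeatsCount-suc k ⟩
    2 * onlyFirstBlockRepeatsCount (1 + k) ≡⟨ cong (2 *_) (NCNi≡onlyFirstBlockRepeatsCount k) ⟨
    2 * NCNi (2 + k)                      ∎
    where open ≡-Reasoning
  doubling (suc zero)       (s≤s ())
  doubling (suc (suc zero)) (s≤s (s≤s ()))
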